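{- Let $\mathcal M=(X,d_a,d_b,[\![\cdot]\!])$ be a bitopological derivative model, where $d_a,d_b$ are the Cantor derivatives of topologies $\mathcal T_a,\mathcal T_b$ on $X$, such that the formula ${\tt Two}$ is true at every point of $\mathcal M$. Then for every $\iota\in\{a,b\}$ and every $x\in X$ there is a unique $y\in X$ (denoted $S_\iota(x)$) such that $y\neq x$ and $\{x,y\}$ is an atomic $\iota$-open set, i.e. $\{x,y\}\in\mathcal T_\iota$ and no nonempty proper subset of $\{x,y\}$ belongs to $\mathcal T_\iota$.
   Context: Formulas are those of the modal language with atoms (including a designated atom ${\tt whole}$), Booleans and modalities $\langle a\rangle,\langle b\rangle$; $[\iota]\varphi:=\neg\langle\iota\rangle\neg\varphi$. Truth: $x\models\langle\iota\rangle\varphi$ iff $x\in d_\iota([\![\varphi]\!])$, where for a topology $\mathcal T$ the Cantor derivative is $d_{\mathcal T}(A)=\{y: \text{every } \mathcal T\text{ -neighbourhood } U \text{ of } y \text{ meets } A\setminus\{y\}\}$. For $\iota\in\{a,b\}$ let ${\tt Two}_\iota:=({\tt whole}\to([\iota]\neg{\tt whole}\wedge\langle\iota\rangle\neg{\tt whole}))\wedge(\neg{\tt whole}\to([\iota]{\tt whole}\wedge\langle\iota\rangle{\tt whole}))$, and ${\tt Two}:={\tt Two}_a\wedge{\tt Two}_b$. -}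

module Defs where

open import Data.Nat using (ℕ)
open import Level using (Lift; suc; 0ℓ)
open import Data.Product using (Σ; _×_; _,_)
open import Data.Sum using (_⊎_)
open import Data.Empty using (⊥)
open import Data.Unit using (⊤)
open import Relation.Nullary using (¬_)
open import Relation.Binary.PropositionalEquality using (_≡_; _≢_)

Subset : Set → Set₁
Subset X = X → Set

_⊆_ : {X : Set} → Subset X → Subset X → Set
A ⊆ B = ∀ z → A z → B z

record Topology (X : Set) : Set₁ where
  field
    IsOpen      : Subset X → Set
    open-ext    : ∀ {U V} → U ⊆ V → V ⊆ U → IsOpen U → IsOpen V
    open-whole  : IsOpen (λ _ → ⊤)
    open-∩      : ∀ {U V} → IsOpen U → IsOpen V → IsOpen (λ z → U z × V z)
    open-⋃      : (I : Set) (U : I → Subset X) → (∀ i → IsOpen (U i))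
                  → IsOpen (λ z → Σ I λ i → U i z)
open Topology public

deriv : {X : Set} → Topology X → (X → Set₁) → (X → Set₁)
deriv T A y = ∀ U → IsOpen T U → U y → Σ _ λ z → U z × A z × z ≢ y

data Idx : Set where
  a b : Idx

data Formula : Set where
  atom   : ℕ → Formula
  ⊥f     : Formula
  ¬f_    : Formula → Formula
  _∧f_   : Formula → Formula → Formula
  _∨f_   : Formula → Formula → Formula
  _⇒f_   : Formula → Formula → Formula
  ⟨_⟩_   : Idx → Formula → Formula

infixr 6 _∧f_
infixr 5 _∨f_
infixr 4 _⇒f_
infix 7 ¬f_
infix 7 ⟨_⟩_

whole : Formula
whole = atom 0

[_]_ : Idx → Formula → Formula
[ ι ] φ = ¬f (⟨ ι ⟩ (¬f φ))
infix 7 [_]_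

Two-at : Idx → Formula
Two-at ι = (whole ⇒f ([ ι ] (¬f whole) ∧f ⟨ ι ⟩ (¬f whole)))
        ∧f ((¬f whole) ⇒f ([ ι ] whole ∧f ⟨ ι ⟩ whole))

Two : Formula
Two = Two-at a ∧f Two-at b

-- A bitopological derivative model (X, d_a, d_b, ⟦·⟧), with d_ι the Cantor
-- derivative of the topology T ι.
record BiModel : Set₁ where
  field
    X   : Set
    T   : Idx → Topology X
    val : ℕ → Subset X
open BiModel public

-- truth values live in Set₁ because the derivative quantifies over open sets
⟦_⟧ : Formula → (M : BiModel) → X M → Set₁
⟦ atom n ⟧ M x = Lift (suc 0ℓ) (val M n x)
⟦ ⊥f ⟧ M x = Lift (suc 0ℓ) ⊥
⟦ ¬f φ ⟧ M x = ¬ (⟦ φ ⟧ M x)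
⟦ φ ∧f ψ ⟧ M x = ⟦ φ ⟧ M x × ⟦ ψ ⟧ M x
⟦ φ ∨f ψ ⟧ M x = ⟦ φ ⟧ M x ⊎ ⟦ ψ ⟧ M x
⟦ φ ⇒f ψ ⟧ M x = ⟦ φ ⟧ M x → ⟦ ψ ⟧ M x
⟦ ⟨ ι ⟩ φ ⟧ M x = deriv (T M ι) (⟦ φ ⟧ M) x

pair : {X : Set} → X → X → Subset X
pair x y z = (z ≡ x) ⊎ (z ≡ y)

AtomicOpen : {X : Set} → Topology X → Subset X → Set₁
AtomicOpen T S = IsOpen T S
  × (∀ U → U ⊆ S → IsOpen T U → Σ _ U → S ⊆ U)

{-# OPTIONS --safe #-}
-- Write W for the extension of whole and C for its complement. Two says that
-- every point of W is a limit point of C but not of W, and symmetrically for C.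
-- Given x ∈ W, if no set {x, y} with y ≠ x were open, x would be a limit point
-- of W: otherwise some open U ∋ x has U ∩ W = {x}; it contains some y ∈ C, and
-- an open V ∋ y with V ∩ C = {y} must also contain x, because y is a limit point
-- of W; then U ∩ V = {x, y} is open. Since no point is isolated, such a pair is
-- atomic, and uniqueness follows by intersecting two such pairs.
module Submission where

open import Defs
open import Level using (0ℓ; lift; lower)
open import Axiom.ExcludedMiddle using (ExcludedMiddle)
open import Data.Product using (Σ; _×_; _,_; proj₁; proj₂)
open import Data.Sum as Sum using (_⊎_; inj₁; inj₂)
open import Data.Empty using (⊥-elim)
open import Data.Unit using (⊤)
open import Function using (_∘_)
open import Relation.Nullary using (¬_)
open import Relation.Nullary.Decidable using (decidable-stable; toSum)
open import Relation.Binary.PropositionalEquality using (_≡_; _≢_; refl; subst)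

module _ {X : Set} (T : Topology X) where

  LimitPoint : Subset X → X → Set₁
  LimitPoint A x = ∀ U → IsOpen T U → U x → Σ X λ z → U z × A z × z ≢ x

  Alternating : Subset X → Subset X → Set₁
  Alternating A B = ∀ x → A x → ¬ LimitPoint A x × LimitPoint B x

  Perfect : Set₁
  Perfect = ∀ x → LimitPoint (λ _ → ⊤) x

  limitPoint-mono : ∀ {A B : Subset X} {x} → A ⊆ B → LimitPoint A x → LimitPoint B x
  limitPoint-mono A⊆B x∈dA U oU Ux =
    let (z , Uz , Az , z≢x) = x∈dA U oU Ux in z , Uz , A⊆B z Az , z≢x

  deriv⇒limitPoint : ∀ {A′ : X → Set₁} {A : Subset X} {x}
    → (∀ z → A′ z → A z) → deriv T A′ x → LimitPoint A x
  deriv⇒limitPoint A′⊆A x∈dA′ U oU Ux =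
    let (z , Uz , A′z , z≢x) = x∈dA′ U oU Ux in z , Uz , A′⊆A z A′z , z≢x

  limitPoint⇒deriv : ∀ {A : Subset X} {A′ : X → Set₁} {x}
    → (∀ z → A z → A′ z) → LimitPoint A x → deriv T A′ x
  limitPoint⇒deriv A⊆A′ x∈dA U oU Ux =
    let (z , Uz , Az , z≢x) = x∈dA U oU Ux in z , Uz , A⊆A′ z Az , z≢x

  perfect-of-alternating : ∀ {A B : Subset X} → (∀ z → A z ⊎ B z)
    → Alternating A B → Alternating B A → Perfect
  perfect-of-alternating A∪B A-alt B-alt x with A∪B x
  ... | inj₁ Ax = limitPoint-mono _ (proj₂ (A-alt x Ax))
  ... | inj₂ Bx = limitPoint-mono _ (proj₂ (B-alt x Bx))

  pair-open : ∀ {A B U V : Subset X} {x y} → (∀ z → A z ⊎ B z) → LimitPoint A y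
    → IsOpen T U → U x → U y → (∀ z → U z → A z → z ≡ x)
    → IsOpen T V → V y → (∀ z → V z → B z → z ≡ y)
    → IsOpen T (pair x y)
  pair-open {U = U} {V} {x} {y} A∪B y∈dA oU Ux Uy U∩A⊆x oV Vy V∩B⊆y =
    open-ext T U∩V⊆pair pair⊆U∩V oU∩V
    where
    oU∩V : IsOpen T (λ z → U z × V z)
    oU∩V = open-∩ T oU oV

    Vx : V x
    Vx = let (w , (Uw , Vw) , Aw , _) = y∈dA _ oU∩V (Uy , Vy)
         in subst V (U∩A⊆x w Uw Aw) Vw

    U∩V⊆pair : (λ z → U z × V z) ⊆ pair x y
    U∩V⊆pair z (Uz , Vz) = Sum.map (U∩A⊆x z Uz) (V∩B⊆y z Vz) (A∪B z)

    pair⊆U∩V : pair x y ⊆ (λ z → U z × V z)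
    pair⊆U∩V _ (inj₁ refl) = Ux , Vx
    pair⊆U∩V _ (inj₂ refl) = Uy , Vy

  two-point-open : ExcludedMiddle 0ℓ → ∀ {A B : Subset X} → (∀ z → A z ⊎ B z)
    → Alternating A B → Alternating B A
    → ∀ x → A x → Σ X λ y → y ≢ x × IsOpen T (pair x y)
  two-point-open em {A} A∪B A-alt B-alt x Ax =
    decidable-stable em λ no-pair → proj₁ (A-alt x Ax) (x∈dA no-pair)
    where
    only : ∀ {U P : Subset X} {p}
      → ¬ (Σ X λ z → U z × P z × z ≢ p) → ∀ z → U z → P z → z ≡ p
    only no-other z Uz Pz = decidable-stable em λ z≢p → no-other (z , Uz , Pz , z≢p)

    x∈dA : ¬ (Σ X λ y → y ≢ x × IsOpen T (pair x y)) → LimitPoint A x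
    x∈dA no-pair U oU Ux = decidable-stable em λ U∩A⊆x →
      let (y , Uy , By , y≢x) = proj₂ (A-alt x Ax) U oU Ux
          (y∉dB , y∈dA) = B-alt y By
      in y∉dB λ V oV Vy → decidable-stable em λ V∩B⊆y →
           no-pair (y , y≢x , pair-open A∪B y∈dA oU Ux Uy (only U∩A⊆x) oV Vy (only V∩B⊆y))

  pair-atomic : ∀ {x y} → Perfect → y ≢ x → IsOpen T (pair x y) → AtomicOpen T (pair x y)
  pair-atomic {x} {y} perfect y≢x o = o , atomic
    where
    both : ∀ {U w} → U ⊆ pair x y → IsOpen T U → U w → U x × U y
    both {U} {w} U⊆pair oU Uw with perfect w U oU Uw
    ... | z , Uz , _ , z≢w with U⊆pair w Uw | U⊆pair z Uz
    ... | inj₁ refl | inj₁ refl = ⊥-elim (z≢w refl)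
    ... | inj₁ refl | inj₂ refl = Uw , Uz
    ... | inj₂ refl | inj₁ refl = Uz , Uw
    ... | inj₂ refl | inj₂ refl = ⊥-elim (z≢w refl)

    atomic : ∀ U → U ⊆ pair x y → IsOpen T U → Σ _ U → pair x y ⊆ U
    atomic U U⊆pair oU (w , Uw) _ (inj₁ refl) = proj₁ (both U⊆pair oU Uw)
    atomic U U⊆pair oU (w , Uw) _ (inj₂ refl) = proj₂ (both U⊆pair oU Uw)

  atomic-pair-unique : ∀ {x y z}
    → IsOpen T (pair x y) → z ≢ x → AtomicOpen T (pair x z) → z ≡ y
  atomic-pair-unique {x} xy-open z≢x (xz-open , xz-atomic)
    with xz-atomic _ (λ _ → proj₁) (open-∩ T xz-open xy-open)
                   (x , inj₁ refl , inj₁ refl) _ (inj₂ refl)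
  ... | _ , inj₁ z≡x = ⊥-elim (z≢x z≡x)
  ... | _ , inj₂ z≡y = z≡y

Two⇒Two-at : ∀ {M x} ι → ⟦ Two ⟧ M x → ⟦ Two-at ι ⟧ M x
Two⇒Two-at a = proj₁
Two⇒Two-at b = proj₂

Whole : (M : BiModel) → Subset (X M)
Whole M = val M 0

module _ (M : BiModel) (two : ∀ x → ⟦ Two ⟧ M x) (ι : Idx) where

  private
    Tι : Topology (X M)
    Tι = T M ι

    two-at : ∀ x → ⟦ Two-at ι ⟧ M x
    two-at x = Two⇒Two-at {M} ι (two x)

  whole-alternating : Alternating Tι (Whole M) (¬_ ∘ Whole M)
  whole-alternating x w =
    let (¬x∈dW , x∈dC) = proj₁ (two-at x) (lift w)
    in (¬x∈dW ∘ limitPoint⇒deriv Tι λ _ w k → k (lift w))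
     , deriv⇒limitPoint Tι (λ _ k w → k (lift w)) x∈dC

  not-whole-alternating : Alternating Tι (¬_ ∘ Whole M) (Whole M)
  not-whole-alternating x ¬w =
    let (¬x∈dC , x∈dW) = proj₂ (two-at x) (¬w ∘ lower)
    in (¬x∈dC ∘ limitPoint⇒deriv Tι λ _ ¬w w → ¬w (lower w))
     , deriv⇒limitPoint Tι (λ _ → lower) x∈dW

  module _ (em : ExcludedMiddle 0ℓ) where

    private
      W∪C : ∀ z → Whole M z ⊎ ¬ Whole M z
      W∪C z = toSum em

    whole-perfect : Perfect Tι
    whole-perfect = perfect-of-alternating Tι W∪C whole-alternating not-whole-alternating

    whole-two-point-open : ∀ x → Σ (X M) λ y → y ≢ x × IsOpen Tι (pair x y)
    whole-two-point-open x = Sum.[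
        two-point-open Tι em W∪C whole-alternating not-whole-alternating x ,
        two-point-open Tι em (Sum.swap ∘ W∪C) not-whole-alternating whole-alternating x
      ]′ (W∪C x)

mainTheorem4 : ExcludedMiddle 0ℓ → (M : BiModel)
    → (∀ x → ⟦ Two ⟧ M x)
    → (ι : Idx) (x : X M)
    → Σ (X M) λ y → (y ≢ x × AtomicOpen (T M ι) (pair x y))
        × (∀ z → z ≢ x → AtomicOpen (T M ι) (pair x z) → z ≡ y)
mainTheorem4 em M two ι x =
  let (y , y≢x , xy-open) = whole-two-point-open M two ι em x
  in y , (y≢x , pair-atomic (T M ι) (whole-perfect M two ι em) y≢x xy-open)
       , λ _ z≢x → atomic-pair-unique (T M ι) xy-open z≢x
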